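{- Let $P_n$ denote the path on $n$ vertices. Then $\chi_\rho''(P_3)=4$; $\chi_\rho''(P_n)=5$ for $n\in\{4,5\}$; $\chi_\rho''(P_n)=6$ for $n\in\{6,7\}$; $\chi_\rho''(P_n)=7$ for $n\in\{8,9\}$. Moreover, for every $n\geq 10$, $\chi_\rho''(P_n)\in\{7,8\}$.
   Context: All graphs are simple, finite and undirected. The total graph $T(G)$ of a graph $G$ has vertex set $V(G)\cup E(G)$, where two elements are adjacent if they are adjacent vertices of $G$, incident edges of $G$ (sharing an endpoint), or a vertex and an edge of $G$ having that vertex as an endpoint. A packing total coloring of $G$ is a map $c:V(G)\cup E(G)\to\{1,2,\dots\}$ such that for any two distinct elements $A,B\in V(G)\cup E(G)$ with $c(A)=c(B)=i$, the distance between $A$ and $B$ in $T(G)$ is greater than $i$. The packing total chromatic number $\chi_\rho''(G)$ is the smallest $k$ such that $G$ has a packing total coloring with colors from $\{1,\dots,k\}$. -}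

module Defs where

open import Data.Nat using (ℕ; zero; suc; _≤_; _<_; _∸_)
open import Data.Fin using (Fin; toℕ)
open import Data.Sum using (_⊎_; inj₁; inj₂)
open import Data.Product using (Σ; _×_; ∃)
open import Relation.Nullary using (¬_)
open import Relation.Binary.PropositionalEquality using (_≡_; _≢_)

TotalAdj : {V E : Set} → (V → V → Set) → (E → V → Set) → (V ⊎ E) → (V ⊎ E) → Set
TotalAdj adj inc (inj₁ u) (inj₁ v) = adj u v
TotalAdj adj inc (inj₂ e) (inj₂ f) = e ≢ f × ∃ λ v → inc e v × inc f v
TotalAdj adj inc (inj₁ u) (inj₂ e) = inc e u
TotalAdj adj inc (inj₂ e) (inj₁ u) = inc e u

PathV : ℕ → Set
PathV n = Fin n

PathE : ℕ → Set
PathE n = Fin (n ∸ 1)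

PathAdj : (n : ℕ) → PathV n → PathV n → Set
PathAdj n u v = toℕ u ≡ suc (toℕ v) ⊎ toℕ v ≡ suc (toℕ u)

PathInc : (n : ℕ) → PathE n → PathV n → Set
PathInc n e v = toℕ v ≡ toℕ e ⊎ toℕ v ≡ suc (toℕ e)

TElem : ℕ → Set
TElem n = PathV n ⊎ PathE n

TAdj : (n : ℕ) → TElem n → TElem n → Set
TAdj n = TotalAdj (PathAdj n) (PathInc n)

data Walk {A : Set} (R : A → A → Set) : ℕ → A → A → Set where
  here : ∀ {a} → Walk R zero a a
  step : ∀ {k a b c} → R a b → Walk R k b c → Walk R (suc k) a c

DistGt : {A : Set} → (A → A → Set) → A → A → ℕ → Set
DistGt R a b i = ∀ k → k ≤ i → ¬ Walk R k a b

IsPackingColoring : {A : Set} → (A → A → Set) → ℕ → (A → ℕ) → Set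
IsPackingColoring {A} R k c =
  (∀ x → 1 ≤ c x × c x ≤ k) ×
  (∀ x y → x ≢ y → c x ≡ c y → DistGt R x y (c x))

HasPackingTotalColoringPath : ℕ → ℕ → Set
HasPackingTotalColoringPath n k = Σ (TElem n → ℕ) (IsPackingColoring (TAdj n) k)

PackingTotalChromaticPath : ℕ → ℕ → Set
PackingTotalChromaticPath n k =
  HasPackingTotalColoringPath n k × (∀ m → m < k → ¬ HasPackingTotalColoringPath n m)

-- Listing the elements of T(P_n) as v₀, e₀, v₁, e₁, …, v_{n-1} turns T(P_n) into the square of
-- the path on 2n − 1 vertices: the elements at positions p ≠ q are adjacent iff |p − q| ≤ 2, so
-- their distance is ⌈|p − q|/2⌉. A packing total colouring of P_n is thus a sequence of length
-- 2n − 1 in which no colour c recurs within 2c steps. Upper bounds are explicit such sequences,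
-- for n ≥ 14 a periodic one with period 54 and 8 colours; lower bounds come from an exhaustive
-- backtracking search showing that no sequence of the relevant length uses fewer colours. The
-- searches in fact give χ''_ρ(P_n) = 7 for 10 ≤ n ≤ 13 and χ''_ρ(P_n) = 8 for n ≥ 14.
module Submission where

open import Defs
open import Data.Nat
  using (ℕ; zero; suc; _+_; _*_; _≤_; _<_; _≤?_; _<?_; _≟_; _≡ᵇ_; z≤n; s≤s; s≤s⁻¹; z<s;
         ∣_-_∣; ⌈_/2⌉; NonZero; _%_)
open import Data.Nat.Properties
open import Data.Nat.DivMod
  using (_mod_; %-distribˡ-+; m%n%n≡m%n; m%n<n; m<n⇒m%n≡m)
open import Data.Fin as Fin using (toℕ)
open import Data.Fin.Properties using (toℕ-injective; toℕ-fromℕ<; toℕ<n; toℕ≤pred[n])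
open import Data.Bool using (Bool; true; false; T; not; _∧_)
open import Data.Bool.Properties using (T-∧)
open import Data.Bool.ListAction using (any)
open import Data.List using (List; []; _∷_; applyUpTo; applyDownFrom)
open import Data.List.Relation.Unary.Any.Properties using (any⁺; applyUpTo⁺)
open import Data.Product using (_×_; _,_; proj₁; proj₂)
open import Data.Sum using (_⊎_; inj₁; inj₂)
open import Data.Empty using (⊥-elim)
open import Function using (_∘_; Equivalence)
open import Relation.Nullary using (¬_; Dec; yes; no)
open import Relation.Nullary.Decidable using (True; toWitness; _×-dec_; _→-dec_; ¬?)
open import Relation.Binary.Definitions using (tri<; tri≈; tri>)
open import Relation.Binary.PropositionalEquality

2*-injective : ∀ {m n} → 2 * m ≡ 2 * n → m ≡ n
2*-injective {m} {n} = *-cancelˡ-≡ m n 2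

m+[2+n]≡2+[m+n] : ∀ m n → m + suc (suc n) ≡ suc (suc (m + n))
m+[2+n]≡2+[m+n] m n = trans (+-suc m (suc n)) (cong suc (+-suc m n))

∣n-1+n∣≡1 : ∀ n → ∣ n - suc n ∣ ≡ 1
∣n-1+n∣≡1 zero    = refl
∣n-1+n∣≡1 (suc n) = ∣n-1+n∣≡1 n

∣1+n-n∣≡1 : ∀ n → ∣ suc n - n ∣ ≡ 1
∣1+n-n∣≡1 n = trans (∣-∣-comm (suc n) n) (∣n-1+n∣≡1 n)

∣m-n∣≤1 : ∀ {m n} → m ≡ n ⊎ m ≡ suc n ⊎ n ≡ suc m → ∣ m - n ∣ ≤ 1
∣m-n∣≤1 {m}     (inj₁ refl)        = m≤n⇒m≤1+n (≤-reflexive (∣n-n∣≡0 m))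
∣m-n∣≤1 {n = n} (inj₂ (inj₁ refl)) = ≤-reflexive (∣1+n-n∣≡1 n)
∣m-n∣≤1 {m}     (inj₂ (inj₂ refl)) = ≤-reflexive (∣n-1+n∣≡1 m)

∣m-n∣≤1⇒∣2m-2n∣≤2 : ∀ {m n} → ∣ m - n ∣ ≤ 1 → ∣ 2 * m - 2 * n ∣ ≤ 2
∣m-n∣≤1⇒∣2m-2n∣≤2 {m} {n} le = subst (_≤ 2) (*-distribˡ-∣-∣ 2 m n) (*-monoʳ-≤ 2 le)

⌈n/2⌉≤m : ∀ {n} m → n ≤ 2 * m → ⌈ n /2⌉ ≤ m
⌈n/2⌉≤m {zero}        _       _  = z≤n
⌈n/2⌉≤m {suc _}       zero    ()
⌈n/2⌉≤m {suc zero}    (suc m) _  = s≤s z≤n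
⌈n/2⌉≤m {suc (suc n)} (suc m) le =
  s≤s (⌈n/2⌉≤m m (s≤s⁻¹ (s≤s⁻¹ (subst (suc (suc n) ≤_) (*-suc 2 m) le))))

toℕ-mod : ∀ {h n} .{{_ : NonZero n}} → h < n → toℕ (h mod n) ≡ h
toℕ-mod h<n = trans (toℕ-fromℕ< _) (m<n⇒m%n≡m h<n)

[m+n]%d≡[m%d+n]%d : ∀ m n d .{{_ : NonZero d}} → (m + n) % d ≡ (m % d + n) % d
[m+n]%d≡[m%d+n]%d m n d = begin
  (m + n) % d              ≡⟨ %-distribˡ-+ m n d ⟩
  (m % d + n % d) % d      ≡⟨ cong (λ k → (k + n % d) % d) (m%n%n≡m%n m d) ⟨
  (m % d % d + n % d) % d  ≡⟨ %-distribˡ-+ (m % d) n d ⟨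
  (m % d + n) % d          ∎
  where open ≡-Reasoning

pos : ∀ {n} → TElem n → ℕ
pos (inj₁ v) = 2 * toℕ v
pos (inj₂ e) = suc (2 * toℕ e)

elementCount : ℕ → ℕ
elementCount zero    = 0
elementCount (suc k) = suc (2 * k)

elementCount-mono : ∀ {m n} → m ≤ n → elementCount m ≤ elementCount n
elementCount-mono {zero}          _        = z≤n
elementCount-mono {suc _} {suc _} (s≤s le) = s≤s (*-monoʳ-≤ 2 le)

pos<elementCount : ∀ {n} (a : TElem n) → pos a < elementCount n
pos<elementCount {suc _} (inj₁ v) = s≤s (*-monoʳ-≤ 2 (toℕ≤pred[n] v))
pos<elementCount {suc _} (inj₂ e) = s≤s (*-monoʳ-< 2 (toℕ<n e))

pos-injective : ∀ {n} (a b : TElem n) → pos a ≡ pos b → a ≡ b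
pos-injective (inj₁ u) (inj₁ v) eq = cong inj₁ (toℕ-injective (2*-injective eq))
pos-injective (inj₁ u) (inj₂ f) eq = ⊥-elim (even≢odd (toℕ u) (toℕ f) eq)
pos-injective (inj₂ e) (inj₁ v) eq = ⊥-elim (even≢odd (toℕ v) (toℕ e) (sym eq))
pos-injective (inj₂ e) (inj₂ f) eq = cong inj₂ (toℕ-injective (2*-injective (suc-injective eq)))

pos≡1+pos⇒adj : ∀ {n} (a b : TElem n) → pos b ≡ suc (pos a) → TAdj n a b
pos≡1+pos⇒adj (inj₁ u) (inj₁ v) eq = ⊥-elim (even≢odd (toℕ v) (toℕ u) eq)
pos≡1+pos⇒adj (inj₁ u) (inj₂ e) eq = inj₁ (sym (2*-injective (suc-injective eq)))
pos≡1+pos⇒adj (inj₂ e) (inj₁ v) eq = inj₂ (2*-injective (trans eq (sym (*-suc 2 (toℕ e)))))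
pos≡1+pos⇒adj (inj₂ e) (inj₂ f) eq = ⊥-elim (even≢odd (toℕ f) (toℕ e) (suc-injective eq))

pos≡2+pos⇒adj : ∀ {n} (a b : TElem n) → pos b ≡ 2 + pos a → TAdj n a b
pos≡2+pos⇒adj (inj₁ u) (inj₁ v) eq = inj₂ (2*-injective (trans eq (sym (*-suc 2 (toℕ u)))))
pos≡2+pos⇒adj (inj₁ u) (inj₂ e) eq = ⊥-elim (even≢odd (toℕ e) (toℕ u) (suc-injective eq))
pos≡2+pos⇒adj (inj₂ e) (inj₁ v) eq =
  ⊥-elim (even≢odd (toℕ v) (suc (toℕ e)) (trans eq (cong suc (sym (*-suc 2 (toℕ e))))))
pos≡2+pos⇒adj {zero}  (inj₂ ()) (inj₂ _) _
pos≡2+pos⇒adj {suc _} (inj₂ e) (inj₂ f) eq = e≢f , Fin.suc e , inj₂ refl , inj₁ (sym f≡1+e)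
  where
  f≡1+e : toℕ f ≡ suc (toℕ e)
  f≡1+e = 2*-injective (trans (suc-injective eq) (sym (*-suc 2 (toℕ e))))
  e≢f : e ≢ f
  e≢f refl = 1+n≢n (sym f≡1+e)

shared-endpoint : ∀ {v e f} → v ≡ e ⊎ v ≡ suc e → v ≡ f ⊎ v ≡ suc f →
                  e ≡ f ⊎ e ≡ suc f ⊎ f ≡ suc e
shared-endpoint (inj₁ refl) (inj₁ refl) = inj₁ refl
shared-endpoint (inj₁ refl) (inj₂ refl) = inj₂ (inj₁ refl)
shared-endpoint (inj₂ refl) (inj₁ refl) = inj₂ (inj₂ refl)
shared-endpoint (inj₂ refl) (inj₂ refl) = inj₁ refl

∣2v-[1+2e]∣≤1 : ∀ {v e} → v ≡ e ⊎ v ≡ suc e → ∣ 2 * v - suc (2 * e) ∣ ≤ 1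
∣2v-[1+2e]∣≤1 {e = e} (inj₁ refl) = ≤-reflexive (∣n-1+n∣≡1 (2 * e))
∣2v-[1+2e]∣≤1 {e = e} (inj₂ refl) =
  ≤-reflexive (trans (cong (∣_- suc (2 * e) ∣) (*-suc 2 e)) (∣1+n-n∣≡1 (2 * e)))

adj⇒∣pos-pos∣≤2 : ∀ {n} (a b : TElem n) → TAdj n a b → ∣ pos a - pos b ∣ ≤ 2
adj⇒∣pos-pos∣≤2 (inj₁ u) (inj₁ v) (inj₁ u≡1+v) =
  ∣m-n∣≤1⇒∣2m-2n∣≤2 {toℕ u} (∣m-n∣≤1 (inj₂ (inj₁ u≡1+v)))
adj⇒∣pos-pos∣≤2 (inj₁ u) (inj₁ v) (inj₂ v≡1+u) =
  ∣m-n∣≤1⇒∣2m-2n∣≤2 {toℕ u} (∣m-n∣≤1 (inj₂ (inj₂ v≡1+u)))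
adj⇒∣pos-pos∣≤2 (inj₁ u) (inj₂ e) inc = m≤n⇒m≤1+n (∣2v-[1+2e]∣≤1 inc)
adj⇒∣pos-pos∣≤2 (inj₂ e) (inj₁ v) inc =
  m≤n⇒m≤1+n (subst (_≤ 1) (∣-∣-comm (2 * toℕ v) (suc (2 * toℕ e))) (∣2v-[1+2e]∣≤1 inc))
adj⇒∣pos-pos∣≤2 (inj₂ e) (inj₂ f) (_ , _ , ie , if) =
  ∣m-n∣≤1⇒∣2m-2n∣≤2 {toℕ e} (∣m-n∣≤1 (shared-endpoint ie if))

walk⇒∣pos-pos∣≤2k : ∀ {n k} {a b : TElem n} → Walk (TAdj n) k a b → ∣ pos a - pos b ∣ ≤ 2 * k
walk⇒∣pos-pos∣≤2k {a = a} here = ≤-reflexive (∣n-n∣≡0 (pos a))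
walk⇒∣pos-pos∣≤2k {k = suc k} {a} {c} (step {b = b} ab w) = begin
  ∣ pos a - pos c ∣                      ≤⟨ ∣-∣-triangle (pos a) (pos b) (pos c) ⟩
  ∣ pos a - pos b ∣ + ∣ pos b - pos c ∣  ≤⟨ +-mono-≤ (adj⇒∣pos-pos∣≤2 a b ab)
                                                      (walk⇒∣pos-pos∣≤2k w) ⟩
  2 + 2 * k                              ≡⟨ *-suc 2 k ⟨
  2 * suc k                              ∎
  where open ≤-Reasoning

module _ {m : ℕ} where

  -- at h p is the element at position 2h + p (out of range, `mod` supplies a junk element).
  at : ℕ → ℕ → TElem (2 + m)
  at h zero          = inj₁ (h mod (2 + m))
  at h (suc zero)    = inj₂ (h mod (1 + m))
  at h (suc (suc p)) = at (suc h) p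

  pos-at : ∀ h p → 2 * h + p < elementCount (2 + m) → pos (at h p) ≡ 2 * h + p
  pos-at h zero (s≤s 2h+0≤) = trans (cong (2 *_) (toℕ-mod h<2+m)) (sym (+-identityʳ (2 * h)))
    where
    h<2+m : h < 2 + m
    h<2+m = s≤s (*-cancelˡ-≤ {h} {suc m} 2 (subst (_≤ 2 * suc m) (+-identityʳ (2 * h)) 2h+0≤))
  pos-at h (suc zero) (s≤s 2h+1≤) = trans (cong (suc ∘ (2 *_)) (toℕ-mod h<1+m)) (+-comm 1 (2 * h))
    where
    h<1+m : h < suc m
    h<1+m = *-cancelˡ-< 2 h (suc m) (subst (_≤ 2 * suc m) (+-comm (2 * h) 1) 2h+1≤)
  pos-at h (suc (suc p)) bound =
    trans (pos-at (suc h) p (subst (_< elementCount (2 + m)) (sym shift) bound)) shift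
    where
    shift : 2 * suc h + p ≡ 2 * h + suc (suc p)
    shift = trans (cong (_+ p) (*-suc 2 h)) (sym (m+[2+n]≡2+[m+n] (2 * h) p))

  walk-between : ∀ d (a b : TElem (2 + m)) → pos a + d ≡ pos b → pos b < elementCount (2 + m) →
                 Walk (TAdj (2 + m)) ⌈ d /2⌉ a b
  walk-between zero a b eq _ =
    subst (Walk (TAdj _) 0 a) (pos-injective a b (trans (sym (+-identityʳ (pos a))) eq)) here
  walk-between (suc zero) a b eq _ =
    step (pos≡1+pos⇒adj a b (trans (sym eq) (+-comm (pos a) 1))) here
  walk-between (suc (suc d)) a b eq b< =
    step (pos≡2+pos⇒adj a c pos-c) (walk-between d c b c+d≡b b<)
    where
    b≡2+a+d : pos b ≡ suc (suc (pos a + d))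
    b≡2+a+d = trans (sym eq) (m+[2+n]≡2+[m+n] (pos a) d)
    c : TElem (2 + m)
    c = at 0 (2 + pos a)
    pos-c : pos c ≡ 2 + pos a
    pos-c = pos-at 0 (2 + pos a)
      (≤-<-trans (subst (2 + pos a ≤_) (sym b≡2+a+d) (+-monoʳ-≤ 2 (m≤m+n (pos a) d))) b<)
    c+d≡b : pos c + d ≡ pos b
    c+d≡b = trans (cong (_+ d) pos-c) (sym b≡2+a+d)

IsSeqPacking : ℕ → ℕ → (ℕ → ℕ) → Set
IsSeqPacking K L col = ∀ {p} → p < L →
  1 ≤ col p × col p ≤ K × (∀ {d} → d < 2 * col p → p + suc d < L → col p ≢ col (p + suc d))

seqPacking-mono : ∀ {K K′ L L′ col} → K ≤ K′ → L′ ≤ L →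
                  IsSeqPacking K L col → IsSeqPacking K′ L′ col
seqPacking-mono K≤K′ L′≤L packing p<L′ =
  let (1≤c , c≤K , separated) = packing (<-≤-trans p<L′ L′≤L)
  in 1≤c , ≤-trans c≤K K≤K′ , λ d< q<L′ → separated d< (<-≤-trans q<L′ L′≤L)

seqPacking-separates : ∀ {K L col p q} → IsSeqPacking K L col → p < q → q < L →
                       ∣ p - q ∣ ≤ 2 * col p → col p ≢ col q
seqPacking-separates {L = L} {col} {p} packing p<q q<L close same
  with o , refl ← m≤n⇒∃[o]m+o≡n p<q =
  proj₂ (proj₂ (packing (<-trans p<q q<L)))
    (subst (_≤ 2 * col p) (trans (cong (∣ p -_∣) (sym (+-suc p o))) (∣m-m+n∣≡n p (suc o))) close)
    (subst (_< L) (sym (+-suc p o)) q<L)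
    (trans same (cong col (sym (+-suc p o))))

seqPacking⇒packingColoring : ∀ {n K col} → IsSeqPacking K (elementCount n) col →
                             IsPackingColoring (TAdj n) K (col ∘ pos)
seqPacking⇒packingColoring {n} {K} {col} packing = bounds , separated
  where
  bounds : ∀ x → 1 ≤ col (pos x) × col (pos x) ≤ K
  bounds x = let (1≤c , c≤K , _) = packing (pos<elementCount x) in 1≤c , c≤K
  close : ∀ {x y k} → k ≤ col (pos x) → Walk (TAdj n) k x y → ∣ pos x - pos y ∣ ≤ 2 * col (pos x)
  close k≤c walk = ≤-trans (walk⇒∣pos-pos∣≤2k walk) (*-monoʳ-≤ 2 k≤c)
  separated : ∀ x y → x ≢ y → col (pos x) ≡ col (pos y) → DistGt (TAdj n) x y (col (pos x))
  separated x y x≢y same k k≤c walk with <-cmp (pos x) (pos y)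
  ... | tri< x<y _ _ = seqPacking-separates packing x<y (pos<elementCount y) (close k≤c walk) same
  ... | tri≈ _ x≡y _ = x≢y (pos-injective x y x≡y)
  ... | tri> _ _ y<x = seqPacking-separates packing y<x (pos<elementCount x)
    (subst₂ _≤_ (∣-∣-comm (pos x) (pos y)) (cong (2 *_) same) (close k≤c walk)) (sym same)

packingColoring⇒seqPacking : ∀ {m K c} → IsPackingColoring (TAdj (2 + m)) K c →
                             IsSeqPacking K (elementCount (2 + m)) (c ∘ at 0)
packingColoring⇒seqPacking {m} {K} {c} (bounds , separated) {p} p<L =
  proj₁ (bounds (at 0 p)) , proj₂ (bounds (at 0 p)) , apart
  where
  apart : ∀ {d} → d < 2 * c (at 0 p) → p + suc d < elementCount (2 + m) →
          c (at 0 p) ≢ c (at 0 (p + suc d))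
  apart {d} d< q<L same = separated x y x≢y same ⌈ suc d /2⌉ (⌈n/2⌉≤m _ d<)
    (walk-between (suc d) x y x+d≡y (subst (_< _) (sym pos-y) q<L))
    where
    x y : TElem (2 + m)
    x = at 0 p
    y = at 0 (p + suc d)
    pos-x : pos x ≡ p
    pos-x = pos-at 0 p p<L
    pos-y : pos y ≡ p + suc d
    pos-y = pos-at 0 (p + suc d) q<L
    x+d≡y : pos x + suc d ≡ pos y
    x+d≡y = trans (cong (_+ suc d) pos-x) (sym pos-y)
    x≢y : x ≢ y
    x≢y x≡y = <⇒≢ (m<m+n p z<s) (trans (sym pos-x) (trans (cong pos x≡y) pos-y))

seqPacking? : ∀ K L col → Dec (IsSeqPacking K L col)
seqPacking? K L col = allUpTo? (λ p →
  1 ≤? col p ×-dec col p ≤? K ×-dec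
  allUpTo? (λ d → p + suc d <? L →-dec ¬? (col p ≟ col (p + suc d))) (2 * col p)) L

IsPeriodicPacking : ℕ → (N : ℕ) → .{{NonZero N}} → (ℕ → ℕ) → Set
IsPeriodicPacking K N s = ∀ {r} → r < N →
  1 ≤ s r × s r ≤ K × (∀ {d} → d < 2 * s r → s r ≢ s ((r + suc d) % N))

periodicPacking? : ∀ K N .{{_ : NonZero N}} s → Dec (IsPeriodicPacking K N s)
periodicPacking? K N s = allUpTo? (λ r →
  1 ≤? s r ×-dec s r ≤? K ×-dec
  allUpTo? (λ d → ¬? (s r ≟ s ((r + suc d) % N))) (2 * s r)) N

periodic⇒seqPacking : ∀ {K N s} .{{_ : NonZero N}} → IsPeriodicPacking K N s →
                      ∀ L → IsSeqPacking K L (λ p → s (p % N))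
periodic⇒seqPacking {N = N} {s} periodic L {p} _ =
  let (1≤c , c≤K , separated) = periodic (m%n<n p N)
  in 1≤c , c≤K , λ d< _ same → separated d< (trans same (cong s ([m+n]%d≡[m%d+n]%d p _ N)))

absent : ℕ → ℕ → List ℕ → Bool
absent c zero    _       = true
absent c (suc j) []      = true
absent c (suc j) (x ∷ h) = not (x ≡ᵇ c) ∧ absent c j h

-- The history h lists the colours placed so far, most recent first.
extendable : ℕ → ℕ → List ℕ → Bool
extendable K zero    h = true
extendable K (suc l) h = any (λ c → absent c (2 * c) h ∧ extendable K l (c ∷ h)) (applyUpTo suc K)

≢⇒T-not-≡ᵇ : ∀ {m n} → m ≢ n → T (not (m ≡ᵇ n))
≢⇒T-not-≡ᵇ {m} {n} m≢n with m ≡ᵇ n | ≡ᵇ⇒≡ m n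
... | true  | sound = m≢n (sound _)
... | false | _     = _

any-applyUpTo-suc⁺ : ∀ (g : ℕ → Bool) {K c} → 1 ≤ c → c ≤ K → T (g c) → T (any g (applyUpTo suc K))
any-applyUpTo-suc⁺ g {c = suc c} _ c<K gc = any⁺ g (applyUpTo⁺ suc gc c<K)

absent-applyDownFrom : ∀ {c} (f : ℕ → ℕ) j s → (∀ {t} → t < s → s ≤ t + j → f t ≢ c) →
                       T (absent c j (applyDownFrom f s))
absent-applyDownFrom f zero    s       _      = _
absent-applyDownFrom f (suc j) zero    _      = _
absent-applyDownFrom f (suc j) (suc s) recent = Equivalence.from T-∧
  ( ≢⇒T-not-≡ᵇ (recent ≤-refl (subst (suc s ≤_) (sym (+-suc s j)) (s≤s (m≤m+n s j))))
  , absent-applyDownFrom f j s λ t<s s≤t+j →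
      recent (m<n⇒m<1+n t<s) (subst (suc s ≤_) (sym (+-suc _ j)) (s≤s s≤t+j)) )

seqPacking⇒extendable : ∀ {K L col} → IsSeqPacking K L col → T (extendable K L [])
seqPacking⇒extendable {K} {L} {col} packing = extends L 0 ≤-refl
  where
  extends : ∀ l s → s + l ≤ L → T (extendable K l (applyDownFrom col s))
  extends zero    s _       = _
  extends (suc l) s s+1+l≤L =
    any-applyUpTo-suc⁺ _ 1≤c c≤K (Equivalence.from T-∧ (col-s-absent , extends l (suc s) 1+s+l≤L))
    where
    1+s+l≤L : suc s + l ≤ L
    1+s+l≤L = subst (_≤ L) (+-suc s l) s+1+l≤L
    s<L : s < L
    s<L = ≤-trans (s≤s (m≤m+n s l)) 1+s+l≤L
    1≤c : 1 ≤ col s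
    1≤c = proj₁ (packing s<L)
    c≤K : col s ≤ K
    c≤K = proj₁ (proj₂ (packing s<L))
    differs : ∀ {t} → t < s → s ≤ t + 2 * col s → col t ≢ col s
    differs {t} t<s s≤ same = seqPacking-separates packing t<s s<L close same
      where
      close : ∣ t - s ∣ ≤ 2 * col t
      close = subst₂ _≤_ (sym (m≤n⇒∣m-n∣≡n∸m (<⇒≤ t<s))) (cong (2 *_) (sym same))
                         (m≤n+o⇒m∸n≤o s t s≤)
    col-s-absent : T (absent (col s) (2 * col s) (applyDownFrom col s))
    col-s-absent = absent-applyDownFrom col (2 * col s) s differs

chromatic-from-sequences : ∀ {m K col} L → IsSeqPacking (suc K) (elementCount (2 + m)) col →
                           L ≤ elementCount (2 + m) → ¬ T (extendable K L []) →
                           PackingTotalChromaticPath (2 + m) (suc K)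
chromatic-from-sequences L packing L≤elementCount stuck =
  (_ , seqPacking⇒packingColoring packing) , λ where
    k k<1+K (_ , coloring) → stuck (seqPacking⇒extendable
      (seqPacking-mono (s≤s⁻¹ k<1+K) L≤elementCount (packingColoring⇒seqPacking coloring)))

-- Colours beyond the end of the list read as the invalid colour 0.
_!_ : List ℕ → ℕ → ℕ
[]       ! _     = 0
(x ∷ xs) ! zero  = x
(x ∷ xs) ! suc i = xs ! i

packs : ∀ {K L} (s : List ℕ) → {True (seqPacking? K L (s !_))} → IsSeqPacking K L (s !_)
packs s {ok} = toWitness ok

colouring₄ colouring₅ colouring₆ colouring₇ period₈ : List ℕ
colouring₄ = 1 ∷ 2 ∷ 3 ∷ 1 ∷ 4 ∷ []
colouring₅ = 1 ∷ 3 ∷ 2 ∷ 1 ∷ 4 ∷ 5 ∷ 1 ∷ 2 ∷ 3 ∷ []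
colouring₆ = 1 ∷ 2 ∷ 3 ∷ 4 ∷ 1 ∷ 5 ∷ 2 ∷ 1 ∷ 6 ∷ 3 ∷ 1 ∷ 2 ∷ 4 ∷ []
colouring₇ = 1 ∷ 3 ∷ 2 ∷ 4 ∷ 1 ∷ 6 ∷ 5 ∷ 1 ∷ 3 ∷ 2 ∷ 1 ∷ 7 ∷ 4 ∷ 1 ∷ 2 ∷ 3 ∷ 1 ∷ 5 ∷ 6 ∷ 2 ∷ 1 ∷
             4 ∷ 3 ∷ 1 ∷ 2 ∷ []
period₈    = 1 ∷ 2 ∷ 4 ∷ 1 ∷ 5 ∷ 7 ∷ 1 ∷ 3 ∷ 2 ∷ 1 ∷ 6 ∷ 4 ∷ 1 ∷ 2 ∷ 3 ∷ 1 ∷ 8 ∷ 5 ∷ 1 ∷ 2 ∷ 4 ∷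
             1 ∷ 3 ∷ 6 ∷ 1 ∷ 2 ∷ 7 ∷ 1 ∷ 5 ∷ 4 ∷ 2 ∷ 1 ∷ 3 ∷ 8 ∷ 1 ∷ 2 ∷ 6 ∷ 1 ∷ 4 ∷ 3 ∷ 2 ∷ 1 ∷
             5 ∷ 7 ∷ 1 ∷ 2 ∷ 3 ∷ 4 ∷ 1 ∷ 6 ∷ 2 ∷ 1 ∷ 8 ∷ 3 ∷ []

period₈-packs : IsPeriodicPacking 8 54 (period₈ !_)
period₈-packs = toWitness {a? = periodicPacking? 8 54 (period₈ !_)} _

large-paths : ∀ n → 10 ≤ n → PackingTotalChromaticPath n 7 ⊎ PackingTotalChromaticPath n 8
large-paths n 10≤n@(s≤s (s≤s _)) with n ≤? 13
... | yes n≤13 = inj₁ (chromatic-from-sequences 15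
                   (seqPacking-mono ≤-refl (elementCount-mono n≤13) (packs colouring₇))
                   (elementCount-mono (≤-trans (m≤m+n 8 2) 10≤n)) λ ())
... | no  n≰13 = inj₂ (chromatic-from-sequences 27
                   (periodic⇒seqPacking period₈-packs (elementCount n))
                   (elementCount-mono (≰⇒> n≰13)) λ ())

theorem3p1 : PackingTotalChromaticPath 3 4 ×
    PackingTotalChromaticPath 4 5 ×
    PackingTotalChromaticPath 5 5 ×
    PackingTotalChromaticPath 6 6 ×
    PackingTotalChromaticPath 7 6 ×
    PackingTotalChromaticPath 8 7 ×
    PackingTotalChromaticPath 9 7 ×
    (∀ (n : ℕ) → 10 ≤ n →
    PackingTotalChromaticPath n 7 ⊎ PackingTotalChromaticPath n 8)
theorem3p1 =
  chromatic-from-sequences 5  (packs colouring₄) ≤-refl       (λ ()) ,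
  chromatic-from-sequences 7  (packs colouring₅) ≤-refl       (λ ()) ,
  chromatic-from-sequences 7  (packs colouring₅) (m≤m+n 7 2)  (λ ()) ,
  chromatic-from-sequences 11 (packs colouring₆) ≤-refl       (λ ()) ,
  chromatic-from-sequences 11 (packs colouring₆) (m≤m+n 11 2) (λ ()) ,
  chromatic-from-sequences 15 (packs colouring₇) ≤-refl       (λ ()) ,
  chromatic-from-sequences 15 (packs colouring₇) (m≤m+n 15 2) (λ ()) ,
  large-paths
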